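{- Let $n \geq 6$ and let $H$ be any graph. Then $\mathrm{gp}^-(W_n \,\square\, H) = 3$, unless $H$ has a maximal general position set consisting of two adjacent vertices.
   Context: All graphs are simple and undirected. The wheel $W_n$ is the join $C_{n-1} \vee K_1$ (a cycle of length $n-1$ together with a vertex adjacent to all cycle vertices). A set $S \subseteq V(G)$ is in general position if no shortest path of $G$ contains three vertices of $S$; $\mathrm{gp}^-(G)$ is the order of a smallest maximal general position set of $G$. The Cartesian product $G \,\square\, H$ has vertex set $V(G)\times V(H)$, with $(u_1,v_1) \sim (u_2,v_2)$ iff either $u_1=u_2$ and $v_1 \sim v_2$ in $H$, or $u_1 \sim u_2$ in $G$ and $v_1 = v_2$. -}

module Defs where

open import Level using (0ℓ)
open import Data.Nat using (ℕ; zero; suc; _≤_; _∸_)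
open import Data.Fin using (Fin; toℕ)
open import Data.Maybe using (Maybe; just; nothing)
open import Data.Product using (Σ; _×_; _,_; ∃)
open import Data.Sum using (_⊎_)
open import Data.Unit using (⊤)
open import Data.Empty using (⊥)
open import Data.List using (List; []; _∷_; length)
open import Data.List.Membership.Propositional using (_∈_; _∉_)
open import Data.List.Relation.Unary.Unique.Propositional using (Unique)
open import Relation.Nullary using (¬_)
open import Relation.Binary.PropositionalEquality using (_≡_; _≢_)
open import Relation.Binary.Definitions using (Decidable; DecidableEquality)

record Graph : Set₁ where
  field
    V   : Set
    Adj : V → V → Set
open Graph public

record FiniteSimple (G : Graph) : Set where
  field
    sym      : ∀ {u v} → Adj G u v → Adj G v u
    irrefl   : ∀ {u} → ¬ Adj G u u
    decEq    : DecidableEquality (V G)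
    decAdj   : Decidable (Adj G)
    vertices : List (V G)
    complete : ∀ v → v ∈ vertices

data Walk (G : Graph) : V G → V G → Set where
  []  : ∀ {u} → Walk G u u
  _∷_ : ∀ {u v w} → Adj G u v → Walk G v w → Walk G u w

len : ∀ {G u v} → Walk G u v → ℕ
len []      = zero
len (_ ∷ p) = suc (len p)

verts : ∀ {G u v} → Walk G u v → List (V G)
verts {u = u} []      = u ∷ []
verts {u = u} (_ ∷ p) = u ∷ verts p

Geodesic : ∀ {G u v} → Walk G u v → Set
Geodesic {G} {u} {v} p = ∀ (q : Walk G u v) → len p ≤ len q

Connected : Graph → Set
Connected G = V G × (∀ u v → Walk G u v)

InGeneralPosition : (G : Graph) → List (V G) → Set
InGeneralPosition G S =
  ∀ {u v} (p : Walk G u v) → Geodesic p →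
  ∀ x y z → x ∈ S → y ∈ S → z ∈ S → x ≢ y → y ≢ z → x ≢ z →
  x ∈ verts p → y ∈ verts p → z ∈ verts p → ⊥

MaximalGP : (G : Graph) → List (V G) → Set
MaximalGP G S =
  Unique S × InGeneralPosition G S ×
  (∀ v → v ∉ S → ¬ InGeneralPosition G (v ∷ S))

GpMinusIs : Graph → ℕ → Set
GpMinusIs G k =
  (Σ (List (V G)) λ S → MaximalGP G S × length S ≡ k) ×
  (∀ S → MaximalGP G S → k ≤ length S)

CycAdj : (m : ℕ) → Fin m → Fin m → Set
CycAdj m i j =
  toℕ i ≢ toℕ j ×
  ( (suc (toℕ i) ≡ toℕ j) ⊎ (suc (toℕ j) ≡ toℕ i)
  ⊎ (suc (toℕ i) ≡ m × toℕ j ≡ 0) ⊎ (suc (toℕ j) ≡ m × toℕ i ≡ 0))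

-- Wheel W_n = C_{n-1} ∨ K_1; the hub is 'nothing'.
WheelAdj : (n : ℕ) → Maybe (Fin (n ∸ 1)) → Maybe (Fin (n ∸ 1)) → Set
WheelAdj n nothing  nothing  = ⊥
WheelAdj n nothing  (just _) = ⊤
WheelAdj n (just _) nothing  = ⊤
WheelAdj n (just i) (just j) = CycAdj (n ∸ 1) i j

Wheel : ℕ → Graph
Wheel n = record { V = Maybe (Fin (n ∸ 1)) ; Adj = WheelAdj n }

_□_ : Graph → Graph → Graph
G □ H = record
  { V   = V G × V H
  ; Adj = λ { (a , b) (c , d) → (a ≡ c × Adj H b d) ⊎ (Adj G a c × b ≡ d) } }

-- The triangle formed by the hub and two consecutive rim vertices of W_n, placed in a single layer
-- W_n × {x₀}, is a maximal general position set of W_n □ H: any other vertex (a , y) reaches the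
-- layer along a geodesic of H, which extends by a geodesic of W_n from a through two triangle
-- vertices. No maximal general position set has fewer than three vertices. Two vertices with
-- different W_n-coordinates are completed by a third one because, for n ≥ 6, every pair of vertices
-- of W_n lies in a triple of which no geodesic contains all three. Two vertices (a , y₁), (a , y₂)
-- with y₁ ≁ y₂ are completed by (c , w) with c ≢ a and w the next vertex on a geodesic from y₁
-- to y₂. If y₁ ∼ y₂, a completion of {y₁ , y₂} in H would lift to W_n □ H, so {y₁ , y₂} would
-- be a maximal general position set of H made of two adjacent vertices.

module Submission where

open import Defs
open import Data.Nat using (ℕ; zero; suc; _+_; _≤_; _<_; z≤n; s≤s)
open import Data.Nat.Properties
  using (_≟_; _<?_; ≤-refl; ≤-trans; ≤-antisym; ≤-pred; <-trans; <⇒≢; ≮⇒≥; 1+n≢n; 1+n≰n; n≤1+n; m≤n+m;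
         +-comm; +-suc; +-mono-≤; +-cancelʳ-≤; +-cancelˡ-≤)
open import Data.Fin using (Fin; zero; suc; toℕ; fromℕ<)
open import Data.Fin.Properties using (toℕ-fromℕ<; toℕ<n) renaming (_≟_ to _≟ᶠ_)
open import Data.Maybe using (just; nothing)
open import Data.Maybe.Properties using (just-injective; ≡-dec)
open import Data.Product using (Σ; ∃₂; _×_; _,_; proj₁; proj₂)
open import Data.Sum using (_⊎_; inj₁; inj₂; [_,_]′)
import Data.Sum as Sum
open import Data.Unit using (tt)
open import Data.Empty using (⊥-elim)
open import Data.List using (List; []; _∷_; length; map)
open import Data.List.Membership.Propositional using (_∈_; _∉_; lose)
open import Data.List.Relation.Unary.Any using (here; there; any?; satisfied)
open import Data.List.Membership.Propositional.Properties using (∈-map⁺; ∈-map⁻)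
open import Data.List.Relation.Unary.All using ([]; _∷_)
open import Data.List.Relation.Unary.AllPairs using ([]; _∷_)
open import Data.List.Relation.Unary.Unique.Propositional using (Unique)
import Data.List.Relation.Unary.Unique.Propositional.Properties as Unique
open import Function using (_∘_)
open import Relation.Nullary using (¬_; Dec; yes; no; contradiction)
open import Relation.Nullary.Decidable using (_×-dec_; _⊎-dec_; ¬?)
open import Relation.Binary.Definitions using (DecidableEquality)
open import Relation.Binary.PropositionalEquality using (_≡_; _≢_; refl; sym; trans; cong; cong₂; subst; subst₂)

Undirected : Graph → Set
Undirected G = ∀ {u v} → Adj G u v → Adj G v u

module _ {G : Graph} where

  infixr 5 _++ʷ_
  _++ʷ_ : ∀ {a b c} → Walk G a b → Walk G b c → Walk G a c
  []      ++ʷ q = q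
  (e ∷ p) ++ʷ q = e ∷ (p ++ʷ q)

  len-++ʷ : ∀ {a b c} (p : Walk G a b) (q : Walk G b c) → len (p ++ʷ q) ≡ len p + len q
  len-++ʷ []      q = refl
  len-++ʷ (e ∷ p) q = cong suc (len-++ʷ p q)

  start∈verts : ∀ {a b} (p : Walk G a b) → a ∈ verts p
  start∈verts []      = here refl
  start∈verts (e ∷ p) = here refl

  end∈verts : ∀ {a b} (p : Walk G a b) → b ∈ verts p
  end∈verts []      = here refl
  end∈verts (e ∷ p) = there (end∈verts p)

  ∈-++ʷ⁺ˡ : ∀ {a b c x} (p : Walk G a b) (q : Walk G b c) → x ∈ verts p → x ∈ verts (p ++ʷ q)
  ∈-++ʷ⁺ˡ []      q (here refl) = start∈verts q
  ∈-++ʷ⁺ˡ (e ∷ p) q (here refl) = here refl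
  ∈-++ʷ⁺ˡ (e ∷ p) q (there x∈p) = there (∈-++ʷ⁺ˡ p q x∈p)

  ∈-++ʷ⁺ʳ : ∀ {a b c x} (p : Walk G a b) (q : Walk G b c) → x ∈ verts q → x ∈ verts (p ++ʷ q)
  ∈-++ʷ⁺ʳ []      q x∈q = x∈q
  ∈-++ʷ⁺ʳ (e ∷ p) q x∈q = there (∈-++ʷ⁺ʳ p q x∈q)

  takeTo : ∀ {a b v} (p : Walk G a b) → v ∈ verts p → Walk G a v
  takeTo []      (here refl) = []
  takeTo (e ∷ p) (here refl) = []
  takeTo (e ∷ p) (there v∈p) = e ∷ takeTo p v∈p

  dropFrom : ∀ {a b v} (p : Walk G a b) → v ∈ verts p → Walk G v b
  dropFrom []      (here refl) = []
  dropFrom (e ∷ p) (here refl) = e ∷ p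
  dropFrom (e ∷ p) (there v∈p) = dropFrom p v∈p

  len-takeTo-dropFrom : ∀ {a b v} (p : Walk G a b) (v∈p : v ∈ verts p) →
                        len p ≡ len (takeTo p v∈p) + len (dropFrom p v∈p)
  len-takeTo-dropFrom []      (here refl) = refl
  len-takeTo-dropFrom (e ∷ p) (here refl) = refl
  len-takeTo-dropFrom (e ∷ p) (there v∈p) = cong suc (len-takeTo-dropFrom p v∈p)

  takeTo-ordered : ∀ {a b y z} (p : Walk G a b) (y∈p : y ∈ verts p) (z∈p : z ∈ verts p) →
                   y ∈ verts (takeTo p z∈p) ⊎ z ∈ verts (takeTo p y∈p)
  takeTo-ordered []      (here refl) (here refl) = inj₁ (here refl)
  takeTo-ordered (e ∷ p) (here refl) z∈p         = inj₁ (start∈verts (takeTo (e ∷ p) z∈p))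
  takeTo-ordered (e ∷ p) (there y∈p) (here refl) = inj₂ (here refl)
  takeTo-ordered (e ∷ p) (there y∈p) (there z∈p) = Sum.map there there (takeTo-ordered p y∈p z∈p)

  geodesic-tail : ∀ {a b c} {e : Adj G a b} {p : Walk G b c} → Geodesic (e ∷ p) → Geodesic p
  geodesic-tail {e = e} g r = ≤-pred (g (e ∷ r))

  geodesic-takeTo : ∀ {a b v} {p : Walk G a b} (v∈p : v ∈ verts p) → Geodesic p → Geodesic (takeTo p v∈p)
  geodesic-takeTo {p = p} v∈p g r =
    +-cancelʳ-≤ (len rest) (len (takeTo p v∈p)) (len r)
      (subst₂ _≤_ (len-takeTo-dropFrom p v∈p) (len-++ʷ r rest) (g (r ++ʷ rest)))
    where rest = dropFrom p v∈p

  len-dropFrom≤ : ∀ {a b v} (p : Walk G a b) (v∈p : v ∈ verts p) → len (dropFrom p v∈p) ≤ len p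
  len-dropFrom≤ p v∈p =
    subst (len (dropFrom p v∈p) ≤_) (sym (len-takeTo-dropFrom p v∈p)) (m≤n+m _ (len (takeTo p v∈p)))

  edge-geodesic : ∀ {a b} → a ≢ b → (e : Adj G a b) → Geodesic {G} (e ∷ [])
  edge-geodesic a≢b e []      = contradiction refl a≢b
  edge-geodesic a≢b e (f ∷ q) = s≤s z≤n

  two-step-geodesic : ∀ {a b c} → a ≢ c → ¬ Adj G a c → (e : Adj G a b) (f : Adj G b c) →
                      Geodesic {G} (e ∷ f ∷ [])
  two-step-geodesic a≢c a≁c e f []          = contradiction refl a≢c
  two-step-geodesic a≢c a≁c e f (e' ∷ [])   = contradiction e' a≁c
  two-step-geodesic a≢c a≁c e f (_ ∷ _ ∷ q) = s≤s (s≤s z≤n)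

Between : (G : Graph) → V G → V G → V G → Set
Between G x a b = Σ (Walk G a b) λ q → Geodesic q × x ∈ verts q

Collinear : (G : Graph) → V G → V G → V G → Set
Collinear G x y z = ∃₂ λ a b → Σ (Walk G a b) λ p → Geodesic p × x ∈ verts p × y ∈ verts p × z ∈ verts p

DiameterAtMostTwo : Graph → Set
DiameterAtMostTwo G = ∀ u v → Σ (Walk G u v) λ q → len q ≤ 2

module _ {G : Graph} where

  between-from-start : ∀ {a b y z} (p : Walk G a b) → Geodesic p → y ∈ verts p → z ∈ verts p →
                       Between G y a z ⊎ Between G z a y
  between-from-start p g y∈p z∈p =
    Sum.map (λ y∈ → takeTo p z∈p , geodesic-takeTo z∈p g , y∈)
            (λ z∈ → takeTo p y∈p , geodesic-takeTo y∈p g , z∈)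
            (takeTo-ordered p y∈p z∈p)

  between⇒collinear : ∀ {x a b} → Between G x a b → Collinear G x a b
  between⇒collinear (q , g , x∈q) = _ , _ , q , g , x∈q , start∈verts q , end∈verts q

  collinear-swap : ∀ {x y z} → Collinear G x y z → Collinear G x z y
  collinear-swap (a , b , p , g , x∈p , y∈p , z∈p) = a , b , p , g , x∈p , z∈p , y∈p

  between-self : ∀ {x a} → Between G x a a → x ≡ a
  between-self ([]    , g , here refl) = refl
  between-self (e ∷ q , g , _)         with g []
  ... | ()

  between-adjacent : ∀ {x a b} → Adj G a b → Between G x a b → x ≡ a ⊎ x ≡ b
  between-adjacent e ([]         , g , here refl)         = inj₁ refl
  between-adjacent e (f ∷ []     , g , here refl)         = inj₁ refl
  between-adjacent e (f ∷ []     , g , there (here refl)) = inj₂ refl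
  between-adjacent e (f ∷ f' ∷ q , g , _)                 with g (e ∷ [])
  ... | s≤s ()

  start-not-between-next : ∀ {a b c} {e : Adj G a b} {p : Walk G b c} → Geodesic (e ∷ p) → ¬ Between G a b c
  start-not-between-next {e = e} {p} g (q , gq , a∈q) =
    1+n≰n (≤-trans (g (dropFrom q a∈q)) (≤-trans (len-dropFrom≤ q a∈q) (gq p)))

  between-diameter₂ : DiameterAtMostTwo G → ∀ {x a b} → Between G x a b → x ≢ a → x ≢ b →
                      Adj G a x × Adj G x b
  between-diameter₂ diam {a = a} {b} (q , g , x∈q) =
    inner q x∈q (≤-trans (g (proj₁ (diam a b))) (proj₂ (diam a b)))
    where
    inner : ∀ {x a b} (q : Walk G a b) → x ∈ verts q → len q ≤ 2 → x ≢ a → x ≢ b → Adj G a x × Adj G x b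
    inner []              (here refl)                 _ x≢a _   = contradiction refl x≢a
    inner (e ∷ [])        (here refl)                 _ x≢a _   = contradiction refl x≢a
    inner (e ∷ [])        (there (here refl))         _ _   x≢b = contradiction refl x≢b
    inner (e ∷ f ∷ [])    (here refl)                 _ x≢a _   = contradiction refl x≢a
    inner (e ∷ f ∷ [])    (there (here refl))         _ _   _   = e , f
    inner (e ∷ f ∷ [])    (there (there (here refl))) _ _   x≢b = contradiction refl x≢b
    inner (_ ∷ _ ∷ _ ∷ _) _ (s≤s (s≤s ())) _ _

module _ {G : Graph} (undirected : Undirected G) where

  reverse : ∀ {a b} → Walk G a b → Walk G b a
  reverse []      = []
  reverse (e ∷ p) = reverse p ++ʷ (undirected e ∷ [])

  len-reverse : ∀ {a b} (p : Walk G a b) → len (reverse p) ≡ len p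
  len-reverse []      = refl
  len-reverse (e ∷ p) =
    trans (len-++ʷ (reverse p) _) (trans (+-comm (len (reverse p)) 1) (cong suc (len-reverse p)))

  ∈-reverse⁺ : ∀ {a b x} (p : Walk G a b) → x ∈ verts p → x ∈ verts (reverse p)
  ∈-reverse⁺ []      x∈p         = x∈p
  ∈-reverse⁺ (e ∷ p) (here refl) = ∈-++ʷ⁺ʳ (reverse p) _ (there (here refl))
  ∈-reverse⁺ (e ∷ p) (there x∈p) = ∈-++ʷ⁺ˡ (reverse p) _ (∈-reverse⁺ p x∈p)

  geodesic-reverse : ∀ {a b} {p : Walk G a b} → Geodesic p → Geodesic (reverse p)
  geodesic-reverse {p = p} g r = subst₂ _≤_ (sym (len-reverse p)) (len-reverse r) (g (reverse r))

  between-sym : ∀ {x a b} → Between G x a b → Between G x b a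
  between-sym (q , g , x∈q) = reverse q , geodesic-reverse g , ∈-reverse⁺ q x∈q

  -- Whichever of x, y, z comes first on the geodesic, the segment from it to the later of the other
  -- two passes through the remaining one.
  collinear⇒between : ∀ {x y z} → Collinear G x y z → x ≢ y →
                      Between G x y z ⊎ Between G y x z ⊎ Between G z x y
  collinear⇒between (_ , _ , p , g , x∈p , y∈p , z∈p) = onGeodesic p g x∈p y∈p z∈p
    where
    onGeodesic : ∀ {a b x y z} (p : Walk G a b) → Geodesic p → x ∈ verts p → y ∈ verts p → z ∈ verts p →
                 x ≢ y → Between G x y z ⊎ Between G y x z ⊎ Between G z x y
    onGeodesic []      g (here refl) (here refl) _ x≢y = contradiction refl x≢y
    onGeodesic (e ∷ p) g (here refl) y∈p z∈p _ =
      [ inj₂ ∘ inj₁ , inj₂ ∘ inj₂ ]′ (between-from-start (e ∷ p) g y∈p z∈p)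
    onGeodesic (e ∷ p) g (there x∈p) (here refl) z∈p _ =
      [ inj₁ , inj₂ ∘ inj₂ ∘ between-sym ]′ (between-from-start (e ∷ p) g (there x∈p) z∈p)
    onGeodesic (e ∷ p) g (there x∈p) (there y∈p) (here refl) _ =
      [ inj₁ ∘ between-sym , inj₂ ∘ inj₁ ∘ between-sym ]′
        (between-from-start (e ∷ p) g (there x∈p) (there y∈p))
    onGeodesic (e ∷ p) g (there x∈p) (there y∈p) (there z∈p) x≢y =
      onGeodesic p (geodesic-tail {e = e} g) x∈p y∈p z∈p x≢y

  ¬between⇒¬collinear : ∀ {x y z} → x ≢ y →
                        ¬ Between G x y z → ¬ Between G y x z → ¬ Between G z x y → ¬ Collinear G x y z
  ¬between⇒¬collinear x≢y x∉yz y∉xz z∉xy c = [ x∉yz , [ y∉xz , z∉xy ]′ ]′ (collinear⇒between c x≢y)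

  triangle⇒¬collinear : ∀ {x y z} → x ≢ y → y ≢ z → x ≢ z →
                        Adj G x y → Adj G y z → Adj G x z → ¬ Collinear G x y z
  triangle⇒¬collinear x≢y y≢z x≢z x∼y y∼z x∼z = ¬between⇒¬collinear x≢y
    (λ b → [ x≢y , x≢z ]′ (between-adjacent y∼z b))
    (λ b → [ x≢y ∘ sym , y≢z ]′ (between-adjacent x∼z b))
    (λ b → [ x≢z ∘ sym , y≢z ∘ sym ]′ (between-adjacent x∼y b))

  diameter₂-¬collinear : DiameterAtMostTwo G → ∀ {x y z} → x ≢ y → x ≢ z → y ≢ z →
                         ¬ Adj G x z → ¬ Adj G y z → ¬ Collinear G x y z
  diameter₂-¬collinear diam x≢y x≢z y≢z x≁z y≁z = ¬between⇒¬collinear x≢y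
    (λ b → x≁z (proj₂ (between-diameter₂ diam b x≢y x≢z)))
    (λ b → y≁z (proj₂ (between-diameter₂ diam b (x≢y ∘ sym) y≢z)))
    (λ b → x≁z (proj₁ (between-diameter₂ diam b (x≢z ∘ sym) (y≢z ∘ sym))))

module _ {G : Graph} where

  inGP⇒¬collinear : ∀ {S x y z} → InGeneralPosition G S → x ∈ S → y ∈ S → z ∈ S →
                       x ≢ y → y ≢ z → x ≢ z → ¬ Collinear G x y z
  inGP⇒¬collinear gp x∈S y∈S z∈S x≢y y≢z x≢z (_ , _ , p , g , x∈p , y∈p , z∈p) =
    gp p g _ _ _ x∈S y∈S z∈S x≢y y≢z x≢z x∈p y∈p z∈p

  inGP-[] : InGeneralPosition G []
  inGP-[] p g x y z ()

  inGP-∷ : ∀ {x S} → InGeneralPosition G S →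
           (∀ {y z} → y ∈ S → z ∈ S → y ≢ z → ¬ Collinear G x y z) →
           InGeneralPosition G (x ∷ S)
  inGP-∷ gp new p g u v w (here refl) (here refl) _ u≢v _ _ _ _ _ = u≢v refl
  inGP-∷ gp new p g u v w (here refl) (there _) (here refl) _ _ u≢w _ _ _ = u≢w refl
  inGP-∷ gp new p g u v w (there _) (here refl) (here refl) _ v≢w _ _ _ _ = v≢w refl
  inGP-∷ gp new p g u v w (here refl) (there v∈S) (there w∈S) u≢v v≢w u≢w u∈p v∈p w∈p =
    new v∈S w∈S v≢w (_ , _ , p , g , u∈p , v∈p , w∈p)
  inGP-∷ gp new p g u v w (there u∈S) (here refl) (there w∈S) u≢v v≢w u≢w u∈p v∈p w∈p =
    new u∈S w∈S u≢w (_ , _ , p , g , v∈p , u∈p , w∈p)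
  inGP-∷ gp new p g u v w (there u∈S) (there v∈S) (here refl) u≢v v≢w u≢w u∈p v∈p w∈p =
    new u∈S v∈S u≢v (_ , _ , p , g , w∈p , u∈p , v∈p)
  inGP-∷ gp new p g u v w (there u∈S) (there v∈S) (there w∈S) =
    gp p g u v w u∈S v∈S w∈S

  inGP-singleton : ∀ {a} → InGeneralPosition G (a ∷ [])
  inGP-singleton = inGP-∷ inGP-[] λ ()

  inGP-pair : ∀ {a b} → InGeneralPosition G (a ∷ b ∷ [])
  inGP-pair = inGP-∷ inGP-singleton λ
    { (here refl) (here refl) y≢z → contradiction refl y≢z
    ; (there ()) _ ; _ (there ()) }

  inGP-triple : ∀ {a b c} → ¬ Collinear G a b c → InGeneralPosition G (a ∷ b ∷ c ∷ [])
  inGP-triple ¬abc = inGP-∷ inGP-pair λ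
    { (here refl)         (here refl)         y≢z → contradiction refl y≢z
    ; (here refl)         (there (here refl)) _   → ¬abc
    ; (there (here refl)) (here refl)         _   → ¬abc ∘ collinear-swap
    ; (there (here refl)) (there (here refl)) y≢z → contradiction refl y≢z
    ; (there (there ())) _ ; _ (there (there ())) }

  ¬maximal-pair : ∀ {z s₁ s₂} → z ≢ s₁ → z ≢ s₂ → ¬ Collinear G z s₁ s₂ →
                  ¬ MaximalGP G (s₁ ∷ s₂ ∷ [])
  ¬maximal-pair z≢s₁ z≢s₂ ¬col (_ , _ , saturated) =
    saturated _ (λ { (here e) → z≢s₁ e ; (there (here e)) → z≢s₂ e ; (there (there ())) }) (inGP-triple ¬col)

module _ {G H : Graph} where

  proj₁ʷ : ∀ {u v} → Walk (G □ H) u v → Walk G (proj₁ u) (proj₁ v)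
  proj₁ʷ []                    = []
  proj₁ʷ (inj₁ (refl , _) ∷ p) = proj₁ʷ p
  proj₁ʷ (inj₂ (e , _)    ∷ p) = e ∷ proj₁ʷ p

  proj₂ʷ : ∀ {u v} → Walk (G □ H) u v → Walk H (proj₂ u) (proj₂ v)
  proj₂ʷ []                    = []
  proj₂ʷ (inj₁ (_ , e)    ∷ p) = e ∷ proj₂ʷ p
  proj₂ʷ (inj₂ (_ , refl) ∷ p) = proj₂ʷ p

  len-proj : ∀ {u v} (p : Walk (G □ H) u v) → len p ≡ len (proj₁ʷ p) + len (proj₂ʷ p)
  len-proj []                    = refl
  len-proj (inj₁ (refl , _) ∷ p) = trans (cong suc (len-proj p)) (sym (+-suc (len (proj₁ʷ p)) _))
  len-proj (inj₂ (_ , refl) ∷ p) = cong suc (len-proj p)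

  ∈-proj₁ʷ : ∀ {u v t} (p : Walk (G □ H) u v) → t ∈ verts p → proj₁ t ∈ verts (proj₁ʷ p)
  ∈-proj₁ʷ []                    (here refl) = here refl
  ∈-proj₁ʷ (inj₁ (refl , _) ∷ p) (here refl) = start∈verts (proj₁ʷ p)
  ∈-proj₁ʷ (inj₁ (refl , _) ∷ p) (there t∈p) = ∈-proj₁ʷ p t∈p
  ∈-proj₁ʷ (inj₂ (_ , refl) ∷ p) (here refl) = here refl
  ∈-proj₁ʷ (inj₂ (_ , refl) ∷ p) (there t∈p) = there (∈-proj₁ʷ p t∈p)

  ∈-proj₂ʷ : ∀ {u v t} (p : Walk (G □ H) u v) → t ∈ verts p → proj₂ t ∈ verts (proj₂ʷ p)
  ∈-proj₂ʷ []                    (here refl) = here refl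
  ∈-proj₂ʷ (inj₁ (refl , _) ∷ p) (here refl) = here refl
  ∈-proj₂ʷ (inj₁ (refl , _) ∷ p) (there t∈p) = there (∈-proj₂ʷ p t∈p)
  ∈-proj₂ʷ (inj₂ (_ , refl) ∷ p) (here refl) = start∈verts (proj₂ʷ p)
  ∈-proj₂ʷ (inj₂ (_ , refl) ∷ p) (there t∈p) = ∈-proj₂ʷ p t∈p

  lift₁ʷ : ∀ {a b} (y : V H) → Walk G a b → Walk (G □ H) (a , y) (b , y)
  lift₁ʷ y []      = []
  lift₁ʷ y (e ∷ r) = inj₂ (e , refl) ∷ lift₁ʷ y r

  lift₂ʷ : ∀ {y y'} (a : V G) → Walk H y y' → Walk (G □ H) (a , y) (a , y')
  lift₂ʷ a []      = []
  lift₂ʷ a (e ∷ s) = inj₁ (refl , e) ∷ lift₂ʷ a s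

  len-lift₁ʷ : ∀ {a b} y (r : Walk G a b) → len (lift₁ʷ y r) ≡ len r
  len-lift₁ʷ y []      = refl
  len-lift₁ʷ y (e ∷ r) = cong suc (len-lift₁ʷ y r)

  len-lift₂ʷ : ∀ {y y'} a (s : Walk H y y') → len (lift₂ʷ a s) ≡ len s
  len-lift₂ʷ a []      = refl
  len-lift₂ʷ a (e ∷ s) = cong suc (len-lift₂ʷ a s)

  ∈-lift₁ʷ⁺ : ∀ {a b c} y (r : Walk G a b) → c ∈ verts r → (c , y) ∈ verts (lift₁ʷ y r)
  ∈-lift₁ʷ⁺ y []      (here refl) = here refl
  ∈-lift₁ʷ⁺ y (e ∷ r) (here refl) = here refl
  ∈-lift₁ʷ⁺ y (e ∷ r) (there c∈r) = there (∈-lift₁ʷ⁺ y r c∈r)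

  infix 6 _×ʷ_
  _×ʷ_ : ∀ {a b y y'} → Walk G a b → Walk H y y' → Walk (G □ H) (a , y) (b , y')
  _×ʷ_ {a} {y' = y'} r s = lift₂ʷ a s ++ʷ lift₁ʷ y' r

  len-×ʷ : ∀ {a b y y'} (r : Walk G a b) (s : Walk H y y') → len (r ×ʷ s) ≡ len r + len s
  len-×ʷ {a} {y' = y'} r s = trans (len-++ʷ (lift₂ʷ a s) (lift₁ʷ y' r))
    (trans (cong₂ _+_ (len-lift₂ʷ a s) (len-lift₁ʷ y' r)) (+-comm (len s) (len r)))

  ∈-×ʷ⁺ : ∀ {a b c y y'} (r : Walk G a b) (s : Walk H y y') → c ∈ verts r → (c , y') ∈ verts (r ×ʷ s)
  ∈-×ʷ⁺ {a} {y' = y'} r s c∈r = ∈-++ʷ⁺ʳ (lift₂ʷ a s) (lift₁ʷ y' r) (∈-lift₁ʷ⁺ y' r c∈r)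

  -- Replacing a projection of p by a shorter walk would give a shorter walk than p.
  geodesic-proj₁ʷ : ∀ {u v} {p : Walk (G □ H) u v} → Geodesic p → Geodesic (proj₁ʷ p)
  geodesic-proj₁ʷ {p = p} g r = +-cancelʳ-≤ (len (proj₂ʷ p)) (len (proj₁ʷ p)) (len r)
    (subst₂ _≤_ (len-proj p) (len-×ʷ r (proj₂ʷ p)) (g (r ×ʷ proj₂ʷ p)))

  geodesic-proj₂ʷ : ∀ {u v} {p : Walk (G □ H) u v} → Geodesic p → Geodesic (proj₂ʷ p)
  geodesic-proj₂ʷ {p = p} g s = +-cancelˡ-≤ (len (proj₁ʷ p)) (len (proj₂ʷ p)) (len s)
    (subst₂ _≤_ (len-proj p) (len-×ʷ (proj₁ʷ p) s) (g (proj₁ʷ p ×ʷ s)))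

  geodesic-×ʷ : ∀ {a b y y'} {r : Walk G a b} {s : Walk H y y'} → Geodesic r → Geodesic s → Geodesic (r ×ʷ s)
  geodesic-×ʷ {r = r} {s} gr gs q = subst₂ _≤_ (sym (len-×ʷ r s)) (sym (len-proj q))
    (+-mono-≤ (gr (proj₁ʷ q)) (gs (proj₂ʷ q)))

  between-proj₁ : ∀ {x a b} → Between (G □ H) x a b → Between G (proj₁ x) (proj₁ a) (proj₁ b)
  between-proj₁ (q , g , x∈q) = proj₁ʷ q , geodesic-proj₁ʷ g , ∈-proj₁ʷ q x∈q

  between-proj₂ : ∀ {x a b} → Between (G □ H) x a b → Between H (proj₂ x) (proj₂ a) (proj₂ b)
  between-proj₂ (q , g , x∈q) = proj₂ʷ q , geodesic-proj₂ʷ g , ∈-proj₂ʷ q x∈q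

  collinear-proj₁ : ∀ {x y z} → Collinear (G □ H) x y z → Collinear G (proj₁ x) (proj₁ y) (proj₁ z)
  collinear-proj₁ (_ , _ , p , g , x∈p , y∈p , z∈p) =
    _ , _ , proj₁ʷ p , geodesic-proj₁ʷ g , ∈-proj₁ʷ p x∈p , ∈-proj₁ʷ p y∈p , ∈-proj₁ʷ p z∈p

  collinear-proj₂ : ∀ {x y z} → Collinear (G □ H) x y z → Collinear H (proj₂ x) (proj₂ y) (proj₂ z)
  collinear-proj₂ (_ , _ , p , g , x∈p , y∈p , z∈p) =
    _ , _ , proj₂ʷ p , geodesic-proj₂ʷ g , ∈-proj₂ʷ p x∈p , ∈-proj₂ʷ p y∈p , ∈-proj₂ʷ p z∈p

  □-undirected : Undirected G → Undirected H → Undirected (G □ H)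
  □-undirected undirG undirH (inj₁ (refl , e)) = inj₁ (refl , undirH e)
  □-undirected undirG undirH (inj₂ (e , refl)) = inj₂ (undirG e , refl)

WalkWithin : (G : Graph) → ℕ → V G → V G → Set
WalkWithin G k u v = Σ (Walk G u v) λ q → len q ≤ k

module _ {G : Graph} (finite : FiniteSimple G) where
  open FiniteSimple finite

  walkWithin? : ∀ k u v → Dec (WalkWithin G k u v)
  walkWithin? k u v with decEq u v
  ... | yes refl = yes ([] , z≤n)
  walkWithin? zero    u v | no u≢v = no λ { ([] , _) → u≢v refl ; (_ ∷ _ , ()) }
  walkWithin? (suc k) u v | no u≢v with any? (λ w → decAdj u w ×-dec walkWithin? k w v) vertices
  ... | yes found with satisfied found
  ...   | w , e , q , q≤k = yes (e ∷ q , s≤s q≤k)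
  walkWithin? (suc k) u v | no u≢v | no none = no λ
    { ([] , _)                       → u≢v refl
    ; (_∷_ {v = w} e q , s≤s q≤k) → none (lose (complete w) (e , q , q≤k)) }

  geodesic-within : ∀ {u v} k (q : Walk G u v) → len q ≤ k → Σ (Walk G u v) Geodesic
  geodesic-within zero    q q≤0 = q , λ r → ≤-trans q≤0 z≤n
  geodesic-within {u} {v} (suc k) q q≤k with walkWithin? k u v
  ... | yes (q' , q'≤k) = geodesic-within k q' q'≤k
  ... | no none         = q , λ r → ≤-trans q≤k (≮⇒≥ λ r<q → none (r , ≤-pred r<q))

  geodesic-exists : Connected G → ∀ u v → Σ (Walk G u v) Geodesic
  geodesic-exists (_ , connected) u v = geodesic-within _ (connected u v) ≤-refl

layer : {A B : Set} → B → List A → List (A × B)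
layer x T = map (_, x) T

SeesTwoOf : (G : Graph) → List (V G) → V G → Set
SeesTwoOf G T a = Σ (V G) λ t₁ → Σ (V G) λ t₂ → t₁ ∈ T × t₂ ∈ T × t₁ ≢ t₂ × Between G t₁ a t₂

module _ {G H : Graph} where

  between-× : ∀ {t a b y x} {s : Walk H y x} → Geodesic s → Between G t a b →
              Between (G □ H) (t , x) (a , y) (b , x)
  between-× {s = s} gs (r , gr , t∈r) = r ×ʷ s , geodesic-×ʷ gr gs , ∈-×ʷ⁺ r s t∈r

  layer-inGP : ∀ {T} x → InGeneralPosition G T → InGeneralPosition (G □ H) (layer x T)
  layer-inGP x gp p g u v w u∈ v∈ w∈ u≢v v≢w u≢w u∈p v∈p w∈p
    with ∈-map⁻ (_, x) u∈ | ∈-map⁻ (_, x) v∈ | ∈-map⁻ (_, x) w∈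
  ... | t , t∈T , refl | t' , t'∈T , refl | t'' , t''∈T , refl =
    gp (proj₁ʷ p) (geodesic-proj₁ʷ g) t t' t'' t∈T t'∈T t''∈T
       (u≢v ∘ cong (_, x)) (v≢w ∘ cong (_, x)) (u≢w ∘ cong (_, x))
       (∈-proj₁ʷ p u∈p) (∈-proj₁ʷ p v∈p) (∈-proj₁ʷ p w∈p)

  layer-maximal : ∀ {T} x → (∀ y → Σ (Walk H y x) Geodesic) →
                  Unique T → InGeneralPosition G T → (∀ a → SeesTwoOf G T a) →
                  MaximalGP (G □ H) (layer x T)
  layer-maximal {T} x geodesic-to-x unique gp sees =
    Unique.map⁺ (cong proj₁) unique , layer-inGP x gp , saturated
    where
    saturated : ∀ v → v ∉ layer x T → ¬ InGeneralPosition (G □ H) (v ∷ layer x T)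
    saturated (a , y) v∉ gp⁺ with sees a | geodesic-to-x y
    ... | t₁ , t₂ , t₁∈T , t₂∈T , t₁≢t₂ , t₁-between | s , gs =
      inGP⇒¬collinear gp⁺ (there t₁x∈) (here refl) (there t₂x∈)
        (λ e → v∉ (subst (_∈ layer x T) e t₁x∈)) (λ e → v∉ (subst (_∈ layer x T) (sym e) t₂x∈))
        (t₁≢t₂ ∘ cong proj₁) (between⇒collinear (between-× gs t₁-between))
      where
      t₁x∈ = ∈-map⁺ (_, x) t₁∈T
      t₂x∈ = ∈-map⁺ (_, x) t₂∈T

PairsExtend : Graph → Set
PairsExtend G = ∀ {a₁ a₂} → a₁ ≢ a₂ → Σ (V G) λ c → c ≢ a₁ × c ≢ a₂ × ¬ Collinear G c a₁ a₂

module _ {G H : Graph} where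

  pair-≢₁-¬maximal : PairsExtend G → ∀ {a₁ a₂ y₁ y₂} → a₁ ≢ a₂ →
                        ¬ MaximalGP (G □ H) ((a₁ , y₁) ∷ (a₂ , y₂) ∷ [])
  pair-≢₁-¬maximal extend {y₁ = y₁} a₁≢a₂ with extend a₁≢a₂
  ... | c , c≢a₁ , c≢a₂ , ¬col =
    ¬maximal-pair {z = c , y₁} (c≢a₁ ∘ cong proj₁) (c≢a₂ ∘ cong proj₁) (¬col ∘ collinear-proj₁)

  pair-≡₁-maximal⇒maximal₂ : ∀ {a y₁ y₂} → MaximalGP (G □ H) ((a , y₁) ∷ (a , y₂) ∷ []) →
                             MaximalGP H (y₁ ∷ y₂ ∷ [])
  pair-≡₁-maximal⇒maximal₂ {a} maximal@(((s₁≢s₂ ∷ []) ∷ [] ∷ []) , _) =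
    ((y₁≢y₂ ∷ []) ∷ [] ∷ []) , inGP-pair , saturated
    where
    y₁≢y₂ = s₁≢s₂ ∘ cong (a ,_)
    saturated : ∀ w → w ∉ _ → ¬ InGeneralPosition H (w ∷ _)
    saturated w w∉ gp = ¬maximal-pair {z = a , w} (w≢y₁ ∘ cong proj₂) (w≢y₂ ∘ cong proj₂)
      (inGP⇒¬collinear gp (here refl) (there (here refl)) (there (there (here refl))) w≢y₁ y₁≢y₂ w≢y₂
        ∘ collinear-proj₂) maximal
      where
      w≢y₁ = w∉ ∘ here
      w≢y₂ = w∉ ∘ there ∘ here

  -- w is closer to y₂ than y₁ is, and as c ≢ a, (c , w) cannot lie between two vertices of {a} × H.
  pair-≡₁-nonadjacent-¬maximal : Undirected G → Undirected H → ∀ {a c y₁ y₂} → c ≢ a →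
    ¬ Adj H y₁ y₂ → Σ (Walk H y₁ y₂) Geodesic → ¬ MaximalGP (G □ H) ((a , y₁) ∷ (a , y₂) ∷ [])
  pair-≡₁-nonadjacent-¬maximal undirG undirH c≢a y₁≁y₂ ([] , _) (((s₁≢s₂ ∷ []) ∷ _) , _) = s₁≢s₂ refl
  pair-≡₁-nonadjacent-¬maximal undirG undirH {a} {c} {y₁} {y₂} c≢a y₁≁y₂ (_∷_ {v = w} e s , g)
                                  maximal@(((s₁≢s₂ ∷ []) ∷ _) , _) =
    ¬maximal-pair {z = c , w} z≢s₁ z≢s₂ ¬col maximal
    where
    z≢s₁ : (c , w) ≢ (a , y₁)
    z≢s₁ = c≢a ∘ cong proj₁
    z≢s₂ : (c , w) ≢ (a , y₂)
    z≢s₂ = c≢a ∘ cong proj₁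
    y₂≢w : y₂ ≢ w
    y₂≢w y₂≡w = y₁≁y₂ (subst (Adj H y₁) (sym y₂≡w) e)
    ¬col : ¬ Collinear (G □ H) (c , w) (a , y₁) (a , y₂)
    ¬col = ¬between⇒¬collinear (□-undirected undirG undirH) z≢s₁
      (λ b → c≢a (between-self (between-proj₁ b)))
      (λ b → start-not-between-next {e = e} g (between-proj₂ b))
      (λ b → [ y₂≢w , s₁≢s₂ ∘ cong (a ,_) ∘ sym ]′ (between-adjacent (undirH e) (between-proj₂ b)))

AdjacentMaximalPair : Graph → Set
AdjacentMaximalPair H = Σ (V H) λ u → Σ (V H) λ v → Adj H u v × MaximalGP H (u ∷ v ∷ [])

module _ {G H : Graph} (undirected : Undirected G) (_≟ᴳ_ : DecidableEquality (V G))
         {u₀ u₁ : V G} (u₀≢u₁ : u₀ ≢ u₁) (extend : PairsExtend G)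
         (finite : FiniteSimple H) (connected : Connected H) where
  open FiniteSimple finite using (decAdj) renaming (sym to undirectedH)

  private
    other : V G → V G
    other a with a ≟ᴳ u₀
    ... | yes _ = u₁
    ... | no  _ = u₀

    other≢ : ∀ a → other a ≢ a
    other≢ a with a ≟ᴳ u₀
    ... | yes refl = u₀≢u₁ ∘ sym
    ... | no  a≢u₀ = a≢u₀ ∘ sym

  3≤order-of-maximal : ¬ AdjacentMaximalPair H → ∀ S → MaximalGP (G □ H) S → 3 ≤ length S
  3≤order-of-maximal _ [] (_ , _ , saturated) =
    ⊥-elim (saturated (u₀ , proj₁ connected) (λ ()) inGP-singleton)
  3≤order-of-maximal _ ((a , y) ∷ []) (_ , _ , saturated) =
    ⊥-elim (saturated (other a , y) (λ { (here e) → other≢ a (cong proj₁ e) ; (there ()) }) inGP-pair)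
  3≤order-of-maximal ¬adjacent ((a₁ , y₁) ∷ (a₂ , y₂) ∷ []) maximal with a₁ ≟ᴳ a₂
  ... | no a₁≢a₂ = ⊥-elim (pair-≢₁-¬maximal extend a₁≢a₂ maximal)
  ... | yes refl with decAdj y₁ y₂
  ...   | yes y₁∼y₂ = ⊥-elim (¬adjacent (y₁ , y₂ , y₁∼y₂ , pair-≡₁-maximal⇒maximal₂ maximal))
  ...   | no  y₁≁y₂ = ⊥-elim (pair-≡₁-nonadjacent-¬maximal undirected undirectedH (other≢ a₁) y₁≁y₂
                               (geodesic-exists finite connected y₁ y₂) maximal)
  3≤order-of-maximal _ (_ ∷ _ ∷ _ ∷ _) _ = s≤s (s≤s (s≤s z≤n))

CycAdjℕ : ℕ → ℕ → ℕ → Set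
CycAdjℕ m a b = (suc a ≡ b) ⊎ (suc b ≡ a) ⊎ (suc a ≡ m × b ≡ 0) ⊎ (suc b ≡ m × a ≡ 0)

cycAdjℕ-sym : ∀ {m a b} → CycAdjℕ m a b → CycAdjℕ m b a
cycAdjℕ-sym (inj₁ e)               = inj₂ (inj₁ e)
cycAdjℕ-sym (inj₂ (inj₁ e))        = inj₁ e
cycAdjℕ-sym (inj₂ (inj₂ (inj₁ e))) = inj₂ (inj₂ (inj₂ e))
cycAdjℕ-sym (inj₂ (inj₂ (inj₂ e))) = inj₂ (inj₂ (inj₁ e))

cycAdjℕ? : ∀ m a b → Dec (CycAdjℕ m a b)
cycAdjℕ? m a b = (suc a ≟ b) ⊎-dec (suc b ≟ a) ⊎-dec
                 ((suc a ≟ m) ×-dec (b ≟ 0)) ⊎-dec ((suc b ≟ m) ×-dec (a ≟ 0))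

¬cycAdjℕ-apart : ∀ {m a b} → 2 + a ≤ b → (a ≡ 0 → suc b ≢ m) → ¬ CycAdjℕ m a b
¬cycAdjℕ-apart 2+a≤b _ (inj₁ refl)                   = 1+n≰n 2+a≤b
¬cycAdjℕ-apart 2+a≤b _ (inj₂ (inj₁ refl))            = 1+n≰n (≤-trans (m≤n+m _ 2) 2+a≤b)
¬cycAdjℕ-apart 2+a≤b _ (inj₂ (inj₂ (inj₁ (_ , refl)))) = contradiction 2+a≤b λ ()
¬cycAdjℕ-apart _ wrap (inj₂ (inj₂ (inj₂ (1+b≡m , a≡0)))) = wrap a≡0 1+b≡m

cycAdj-sym : ∀ {m} {i j : Fin m} → CycAdj m i j → CycAdj m j i
cycAdj-sym (i≢j , i∼j) = i≢j ∘ sym , cycAdjℕ-sym i∼j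

cycAdj? : ∀ m (i j : Fin m) → Dec (CycAdj m i j)
cycAdj? m i j = ¬? (toℕ i ≟ toℕ j) ×-dec cycAdjℕ? m (toℕ i) (toℕ j)

cycAdj-neighbour : ∀ {m} (j : Fin (2 + m)) → Σ (Fin (2 + m)) λ c → CycAdj (2 + m) j c
cycAdj-neighbour {m} j with suc (toℕ j) <? 2 + m
... | yes j+1<m =
  fromℕ< j+1<m , (λ e → 1+n≢n (sym (trans e (toℕ-fromℕ< j+1<m)))) , inj₁ (sym (toℕ-fromℕ< j+1<m))
... | no  j+1≮m = zero , j≢0 , inj₂ (inj₂ (inj₁ (j+1≡m , refl)))
  where
  j+1≡m : suc (toℕ j) ≡ 2 + m
  j+1≡m = ≤-antisym (toℕ<n j) (≮⇒≥ j+1≮m)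
  j≢0 : toℕ j ≢ 0
  j≢0 j≡0 with trans (sym (cong suc j≡0)) j+1≡m
  ... | ()

module _ (k : ℕ) where

  NonNeighbour : ℕ → ℕ → Set
  NonNeighbour b c = c < 5 + k × c ≢ b × ¬ CycAdjℕ (5 + k) c b

  private
    2<m : 2 < 5 + k
    2<m = s≤s (s≤s (s≤s z≤n))
    3<m : 3 < 5 + k
    3<m = s≤s (s≤s (s≤s (s≤s z≤n)))
    4<m : 4 < 5 + k
    4<m = s≤s (s≤s (s≤s (s≤s (s≤s z≤n))))

  nonNeighbour-above : ∀ {b c} → c < 5 + k → 2 + b ≤ c → (b ≡ 0 → suc c ≢ 5 + k) → NonNeighbour b c
  nonNeighbour-above c<m 2+b≤c wrap =
    c<m , (λ { refl → 1+n≰n (≤-trans (n≤1+n _) 2+b≤c) }) , ¬cycAdjℕ-apart 2+b≤c wrap ∘ cycAdjℕ-sym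

  nonNeighbour-below : ∀ {b c} → b < 5 + k → 2 + c ≤ b → (c ≡ 0 → suc b ≢ 5 + k) → NonNeighbour b c
  nonNeighbour-below b<m 2+c≤b wrap =
    <-trans c<b b<m , <⇒≢ c<b , ¬cycAdjℕ-apart 2+c≤b wrap
    where c<b = ≤-trans (n≤1+n _) 2+c≤b

  -- The candidates lie at cyclic distance 2 or 3 from b, which needs a cycle of length at least 5.
  two-non-neighbours : ∀ b → b < 5 + k →
                       Σ ℕ λ c₁ → Σ ℕ λ c₂ → c₁ ≢ c₂ × NonNeighbour b c₁ × NonNeighbour b c₂
  two-non-neighbours 0 _ =
    2 , 3 , (λ ()) , nonNeighbour-above 2<m ≤-refl (λ _ ()) , nonNeighbour-above 3<m (n≤1+n 2) (λ _ ())
  two-non-neighbours 1 _ =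
    3 , 4 , (λ ()) , nonNeighbour-above 3<m ≤-refl (λ ()) , nonNeighbour-above 4<m (n≤1+n 3) (λ ())
  two-non-neighbours 2 b<m =
    0 , 4 , (λ ()) , nonNeighbour-below b<m ≤-refl (λ _ ()) , nonNeighbour-above 4<m ≤-refl (λ ())
  two-non-neighbours (suc (suc (suc b))) b<m =
    suc b , b , 1+n≢n ,
    nonNeighbour-below b<m ≤-refl (λ ()) , nonNeighbour-below b<m (n≤1+n (2 + b)) λ { refl () }

  nonNeighbour-fin : ∀ {c} (i j : Fin (5 + k)) → NonNeighbour (toℕ j) c → c ≢ toℕ i →
                     Σ (Fin (5 + k)) λ c → c ≢ i × c ≢ j × ¬ CycAdj (5 + k) c j
  nonNeighbour-fin i j (c<m , c≢j , c≁j) c≢i =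
    fromℕ< c<m , c≢i ∘ toℕ-≡ , c≢j ∘ toℕ-≡ ,
    c≁j ∘ subst (λ c → CycAdjℕ (5 + k) c (toℕ j)) (toℕ-fromℕ< c<m) ∘ proj₂
    where
    toℕ-≡ : ∀ {x} → fromℕ< c<m ≡ x → _ ≡ toℕ x
    toℕ-≡ e = trans (sym (toℕ-fromℕ< c<m)) (cong toℕ e)

  rim-non-neighbour : (i j : Fin (5 + k)) → Σ (Fin (5 + k)) λ c → c ≢ i × c ≢ j × ¬ CycAdj (5 + k) c j
  rim-non-neighbour i j with two-non-neighbours (toℕ j) (toℕ<n j)
  ... | c₁ , c₂ , c₁≢c₂ , nn₁ , nn₂ with c₁ ≟ toℕ i
  ...   | no  c₁≢i = nonNeighbour-fin i j nn₁ c₁≢i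
  ...   | yes c₁≡i = nonNeighbour-fin i j nn₂ λ c₂≡i → c₁≢c₂ (trans c₁≡i (sym c₂≡i))

wheel-undirected : ∀ n → Undirected (Wheel n)
wheel-undirected n {nothing} {just _}  _   = tt
wheel-undirected n {just _}  {nothing} _   = tt
wheel-undirected n {just _}  {just _}  i∼j = cycAdj-sym i∼j

wheel-diameter₂ : ∀ n → DiameterAtMostTwo (Wheel n)
wheel-diameter₂ n nothing  nothing  = [] , z≤n
wheel-diameter₂ n nothing  (just _) = tt ∷ [] , s≤s z≤n
wheel-diameter₂ n (just _) nothing  = tt ∷ [] , s≤s z≤n
wheel-diameter₂ n (just _) (just _) = _∷_ {v = nothing} tt (tt ∷ []) , s≤s (s≤s z≤n)

module _ (k : ℕ) where

  private
    W : Graph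
    W = Wheel (6 + k)

    undirected : Undirected W
    undirected = wheel-undirected (6 + k)

    just-≢ : ∀ {i j : Fin (5 + k)} → toℕ i ≢ toℕ j → just i ≢ just j
    just-≢ i≢j = i≢j ∘ cong toℕ ∘ just-injective

    via-hub : ∀ {i j} → Walk W (just i) (just j)
    via-hub = _∷_ {v = nothing} tt (tt ∷ [])

    2≁0 : ¬ CycAdj (5 + k) (suc (suc zero)) zero
    2≁0 = ¬cycAdjℕ-apart ≤-refl (λ _ ()) ∘ cycAdjℕ-sym ∘ proj₂

    3+i≁1 : ∀ i → ¬ CycAdj (5 + k) (suc (suc (suc i))) (suc zero)
    3+i≁1 i = ¬cycAdjℕ-apart (s≤s (s≤s (s≤s z≤n))) (λ ()) ∘ cycAdjℕ-sym ∘ proj₂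

  wheel-pairs-extend : PairsExtend W
  wheel-pairs-extend {nothing} {nothing} hub≢hub = contradiction refl hub≢hub
  wheel-pairs-extend {nothing} {just j}  _ with cycAdj-neighbour j
  ... | c , j∼c@(j≢c , _) = just c , (λ ()) , just-≢ (j≢c ∘ sym) ,
    triangle⇒¬collinear undirected (λ ()) (λ ()) (just-≢ (j≢c ∘ sym)) tt tt (cycAdj-sym j∼c)
  wheel-pairs-extend {just i}  {nothing} _ with cycAdj-neighbour i
  ... | c , i∼c@(i≢c , _) = just c , just-≢ (i≢c ∘ sym) , (λ ()) ,
    triangle⇒¬collinear undirected (just-≢ (i≢c ∘ sym)) (λ ()) (λ ()) (cycAdj-sym i∼c) tt tt
  wheel-pairs-extend {just i}  {just j}  i≢j with cycAdj? (5 + k) i j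
  ... | yes i∼j = nothing , (λ ()) , (λ ()) , triangle⇒¬collinear undirected (λ ()) i≢j (λ ()) tt i∼j tt
  ... | no  i≁j with rim-non-neighbour k i j
  ...   | c , c≢i , c≢j , c≁j = just c , c≢i ∘ just-injective , c≢j ∘ just-injective ,
    diameter₂-¬collinear undirected (wheel-diameter₂ _)
      (c≢i ∘ just-injective) (c≢j ∘ just-injective) i≢j c≁j i≁j

  hub-triangle : List (V W)
  hub-triangle = nothing ∷ just zero ∷ just (suc zero) ∷ []

  hub-triangle-unique : Unique hub-triangle
  hub-triangle-unique = ((λ ()) ∷ (λ ()) ∷ []) ∷ ((λ ()) ∷ []) ∷ [] ∷ []

  hub-triangle-inGP : InGeneralPosition W hub-triangle
  hub-triangle-inGP = inGP-triple (triangle⇒¬collinear undirected (λ ()) (λ ()) (λ ()) tt ((λ ()) , inj₁ refl) tt)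

  sees-hub-triangle : ∀ a → SeesTwoOf W hub-triangle a
  sees-hub-triangle nothing =
    nothing , just zero , here refl , there (here refl) , (λ ()) , tt ∷ [] , edge-geodesic (λ ()) tt , here refl
  sees-hub-triangle (just zero) =
    just zero , nothing , there (here refl) , here refl , (λ ()) , tt ∷ [] , edge-geodesic (λ ()) tt , here refl
  sees-hub-triangle (just (suc zero)) =
    just (suc zero) , nothing , there (there (here refl)) , here refl , (λ ()) ,
    tt ∷ [] , edge-geodesic (λ ()) tt , here refl
  sees-hub-triangle (just (suc (suc zero))) =
    nothing , just zero , here refl , there (here refl) , (λ ()) ,
    via-hub , two-step-geodesic {b = nothing} (λ ()) 2≁0 tt tt , there (here refl)
  sees-hub-triangle (just (suc (suc (suc i)))) =
    nothing , just (suc zero) , here refl , there (there (here refl)) , (λ ()) ,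
    via-hub , two-step-geodesic {b = nothing} (λ ()) (3+i≁1 i) tt tt , there (here refl)

corollary2p5 : (n : ℕ) → 6 ≤ n → (H : Graph) → FiniteSimple H → Connected H →
                 ¬ (Σ (V H) λ u → Σ (V H) λ v → Adj H u v × MaximalGP H (u ∷ v ∷ [])) →
                 GpMinusIs (Wheel n □ H) 3
corollary2p5 .(6 + k) (s≤s (s≤s (s≤s (s≤s (s≤s (s≤s (z≤n {k}))))))) H finite connected ¬adjacent =
  (layer x₀ (hub-triangle k) ,
   layer-maximal x₀ (λ y → geodesic-exists finite connected y x₀)
     (hub-triangle-unique k) (hub-triangle-inGP k) (sees-hub-triangle k) ,
   refl) ,
  3≤order-of-maximal (wheel-undirected _) (≡-dec _≟ᶠ_) {u₀ = nothing} {just zero} (λ ()) (wheel-pairs-extend k)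
    finite connected ¬adjacent
  where
  x₀ = proj₁ connected
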